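{- There is an absolute constant $C_0$ such that the following holds for every positive integer $m\ge 2$. Let $T$ be the balanced binary tree with $m$ leaves defined below, and suppose at least a $1/4$ fraction of the nodes of $T$ are marked. If $u$ is chosen uniformly at random among the marked nodes of $T$, then the expected number of nodes of the subtree of $T$ rooted at $u$ is at most $C_0\log m$.
   Context: $T$ is the rooted binary tree with $m$ leaves and $m-1$ internal nodes defined as follows: if $m=2^k$, the complete binary tree of depth $k$; if $2^k<m<2^{k+1}$, the complete binary tree with $2^k$ leaves with a pair of children attached to each of its $m-2^k$ leftmost leaves. The subtree rooted at $u$ consists of $u$ and all its descendants. -}

module Defs where

open import Data.Nat using (ℕ; zero; suc; _+_; _*_; _∸_; _^_; _⊓_; _≤_)
open import Data.Nat.Logarithm using (⌊log₂_⌋)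
open import Data.Bool using (Bool; true; false; if_then_else_)

data BTree : Set where
  leaf : BTree
  node : BTree → BTree → BTree

size : BTree → ℕ
size leaf = 1
size (node l r) = suc (size l + size r)

-- expand k j : complete binary tree of depth k (2^k leaves) in which each of
-- the j leftmost leaves (j ≤ 2^k) receives a pair of children.
expand : ℕ → ℕ → BTree
expand zero zero = leaf
expand zero (suc _) = node leaf leaf
expand (suc k) j = node (expand k (j ⊓ 2 ^ k)) (expand k (j ∸ 2 ^ k))

-- The tree T with m leaves (m ≥ 1): with k = ⌊log₂ m⌋, 2^k ≤ m < 2^(k+1),
-- the complete tree with 2^k leaves, m - 2^k leftmost leaves expanded
-- (nothing expanded when m = 2^k).
T : ℕ → BTree
T m = expand ⌊log₂ m ⌋ (m ∸ 2 ^ ⌊log₂ m ⌋)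

data Marking : BTree → Set where
  mleaf : Bool → Marking leaf
  mnode : ∀ {l r} → Bool → Marking l → Marking r → Marking (node l r)

count : ∀ {t} → Marking t → ℕ
count (mleaf b) = if b then 1 else 0
count (mnode b ml mr) = (if b then 1 else 0) + count ml + count mr

subtreeSum : ∀ {t} → Marking t → ℕ
subtreeSum {leaf} (mleaf b) = if b then 1 else 0
subtreeSum {node l r} (mnode b ml mr) =
  (if b then size (node l r) else 0) + subtreeSum ml + subtreeSum mr

module Submission where

-- Each node v of a tree lies in the subtree of at most (height + 1) nodes,
-- namely its ancestors (itself included).  Hence, summing subtree sizes over
-- any set of marked nodes counts every node at most (height + 1) times:
--
--   subtreeSum M ≤ size t * (height t + 1)        for every tree t, marking M.
--
-- The tree T m is an expanded complete tree of depth k = ⌊log₂ m⌋, whose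
-- height is at most k + 1, so subtreeSum M ≤ size (T m) * (k + 2).  If at
-- least a quarter of the nodes are marked, size (T m) ≤ 4 * count M, and for
-- m ≥ 2 we have k ≥ 1, so k + 2 ≤ 3k.  Altogether the average subtree size
-- over marked nodes is at most 12 ⌊log₂ m⌋, i.e. the theorem with C₀ = 12.

open import Defs
open import Data.Nat using (ℕ; zero; suc; _+_; _*_; _⊔_; _≤_; z≤n; s≤s)
open import Data.Nat.Properties
open import Data.Nat.Logarithm using (⌊log₂_⌋; ⌊log₂⌋-mono-≤)
open import Data.Bool using (Bool; true; false; if_then_else_)
open import Data.Product using (∃-syntax; _,_)
open import Relation.Binary.PropositionalEquality using (_≡_; cong; sym)

height : BTree → ℕ
height leaf = 0
height (node l r) = suc (height l ⊔ height r)

contribution-≤ : ∀ (b : Bool) s → (if b then s else 0) ≤ s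
contribution-≤ true  s = ≤-refl
contribution-≤ false s = z≤n

node-step : ∀ (b : Bool) sₗ sᵣ h x y → x ≤ sₗ * suc h → y ≤ sᵣ * suc h →
  (if b then suc (sₗ + sᵣ) else 0) + x + y ≤ suc (sₗ + sᵣ) * suc (suc h)
node-step b sₗ sᵣ h x y x≤ y≤ = begin
  (if b then s else 0) + x + y ≤⟨ +-monoˡ-≤ y (+-monoˡ-≤ x (contribution-≤ b s)) ⟩
  s + x + y                    ≡⟨ +-assoc s x y ⟩
  s + (x + y)                  ≤⟨ +-monoʳ-≤ s (+-mono-≤ x≤ y≤) ⟩
  s + (sₗ * suc h + sᵣ * suc h) ≡⟨ cong (s +_) (sym (*-distribʳ-+ (suc h) sₗ sᵣ)) ⟩
  s + (sₗ + sᵣ) * suc h        ≤⟨ +-monoʳ-≤ s (*-monoˡ-≤ (suc h) (n≤1+n (sₗ + sᵣ))) ⟩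
  s + s * suc h                ≡⟨ sym (*-suc s (suc h)) ⟩
  s * suc (suc h)              ∎
  where
  open ≤-Reasoning
  s = suc (sₗ + sᵣ)

-- Counting bound: every node lies in at most (h + 1) marked subtrees when the
-- tree has height at most h.
subtreeSum-≤ : ∀ {t} (M : Marking t) h → height t ≤ h →
  subtreeSum M ≤ size t * suc h
subtreeSum-≤ (mleaf b) h _ = ≤-trans (contribution-≤ b 1) (s≤s z≤n)
subtreeSum-≤ {node l r} (mnode b ml mr) (suc h) (s≤s hₗᵣ≤h) =
  node-step b (size l) (size r) h (subtreeSum ml) (subtreeSum mr)
    (subtreeSum-≤ ml h (m⊔n≤o⇒m≤o (height l) (height r) hₗᵣ≤h))
    (subtreeSum-≤ mr h (m⊔n≤o⇒n≤o (height l) (height r) hₗᵣ≤h))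

-- Expanding leaves of the complete tree of depth k adds at most one level.
height-expand : ∀ k j → height (expand k j) ≤ suc k
height-expand zero    zero    = z≤n
height-expand zero    (suc _) = s≤s z≤n
height-expand (suc k) j       = s≤s (⊔-lub (height-expand k _) (height-expand k _))

k+2≤3k : ∀ k → 1 ≤ k → k + 2 ≤ 3 * k
k+2≤3k k 1≤k = +-monoʳ-≤ k (+-mono-≤ 1≤k (+-mono-≤ 1≤k z≤n))

regroup : ∀ c k → 4 * c * (3 * k) ≡ 12 * k * c
regroup c k = begin
  4 * c * (3 * k)   ≡⟨ *-assoc 4 c (3 * k) ⟩
  4 * (c * (3 * k)) ≡⟨ cong (4 *_) (*-comm c (3 * k)) ⟩
  4 * (3 * k * c)   ≡⟨ cong (4 *_) (*-assoc 3 k c) ⟩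
  4 * (3 * (k * c)) ≡⟨ sym (*-assoc 4 3 (k * c)) ⟩
  12 * (k * c)      ≡⟨ sym (*-assoc 12 k c) ⟩
  12 * k * c        ∎
  where open Relation.Binary.PropositionalEquality.≡-Reasoning

lemma24 : ∃[ C₀ ] ((m : ℕ) → 2 ≤ m → (M : Marking (T m)) →
            size (T m) ≤ 4 * count M →
            subtreeSum M ≤ C₀ * ⌊log₂ m ⌋ * count M)
lemma24 = 12 , bound
  where
  bound : (m : ℕ) → 2 ≤ m → (M : Marking (T m)) →
    size (T m) ≤ 4 * count M → subtreeSum M ≤ 12 * ⌊log₂ m ⌋ * count M
  bound m 2≤m M quarter-marked = begin
    subtreeSum M         ≤⟨ subtreeSum-≤ M (suc k) (height-expand k _) ⟩
    size (T m) * (2 + k) ≡⟨ cong (size (T m) *_) (+-comm 2 k) ⟩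
    size (T m) * (k + 2) ≤⟨ *-monoˡ-≤ (k + 2) quarter-marked ⟩
    4 * c * (k + 2)      ≤⟨ *-monoʳ-≤ (4 * c) (k+2≤3k k (⌊log₂⌋-mono-≤ 2≤m)) ⟩
    4 * c * (3 * k)      ≡⟨ regroup c k ⟩
    12 * k * c           ∎
    where
    open ≤-Reasoning
    k = ⌊log₂ m ⌋
    c = count M
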